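{- Let $t \geq 2$ be an integer. If $G$ is a graph with $n$ vertices, minimum degree $d$, and no induced subgraph isomorphic to $K_{2,t+1}$, then \[ \omega (G) \geq \left( \frac{d^2}{2nt} \left( 1 - o(1) \right) \right)^{1/t} - t, \] where $o(1)$ denotes a quantity tending to $0$ as $n \to \infty$.
   Context: $\omega(G)$ is the clique number of $G$, the maximum order of a clique (set of pairwise adjacent vertices) in $G$. -}

module Defs where

open import Data.Nat using (ℕ; suc; _≤_; _+_; _*_; _∸_; _^_)
open import Data.Bool using (Bool; true; false; if_then_else_)
open import Data.Fin using (Fin)
open import Data.Fin.Subset using (Subset; inside; outside; _∈_; ∣_∣)
open import Data.Vec using (tabulate)
open import Data.Sum using (_⊎_; inj₁; inj₂)
open import Data.Product using (Σ; _×_; ∃)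
open import Relation.Binary.PropositionalEquality using (_≡_; _≢_)
open import Function.Definitions using (Injective)

record Graph (n : ℕ) : Set where
  field
    adj     : Fin n → Fin n → Bool
    sym     : ∀ u v → adj u v ≡ adj v u
    loopless : ∀ v → adj v v ≡ false
open Graph public

nbhd : ∀ {n} → Graph n → Fin n → Subset n
nbhd G u = tabulate (λ v → if adj G u v then inside else outside)

degree : ∀ {n} → Graph n → Fin n → ℕ
degree G u = ∣ nbhd G u ∣

IsMinDegree : ∀ {n} → Graph n → ℕ → Set
IsMinDegree G d = (∀ v → d ≤ degree G v) × ∃ (λ v → degree G v ≡ d)

IsClique : ∀ {n} → Graph n → Subset n → Set
IsClique G S = ∀ u v → u ∈ S → v ∈ S → u ≢ v → adj G u v ≡ true

IsCliqueNumber : ∀ {n} → Graph n → ℕ → Set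
IsCliqueNumber G w =
  Σ _ (λ S → IsClique G S × ∣ S ∣ ≡ w) × (∀ S → IsClique G S → ∣ S ∣ ≤ w)

Kadj : ∀ {a b} → (Fin a ⊎ Fin b) → (Fin a ⊎ Fin b) → Bool
Kadj (inj₁ _) (inj₁ _) = false
Kadj (inj₁ _) (inj₂ _) = true
Kadj (inj₂ _) (inj₁ _) = true
Kadj (inj₂ _) (inj₂ _) = false

HasInducedK : ∀ {n} → Graph n → ℕ → ℕ → Set
HasInducedK {n} G a b =
  Σ (Fin a ⊎ Fin b → Fin n) (λ f →
    Injective _≡_ _≡_ f × (∀ x y → adj G (f x) (f y) ≡ Kadj x y))

-- Let u have minimum degree d and neighbourhood S. Two non-adjacent vertices have at
-- most M := R(ω, t + 1) − 1 < (ω + t)^t common neighbours: otherwise their common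
-- neighbourhood holds an ω-clique, which extends to an (ω + 1)-clique, or an independent
-- (t + 1)-set, which yields an induced K_{2,t+1}. Counting the edges leaving S, the
-- non-adjacent ordered pairs inside S number at most nM + d. The vertices of S with fewer
-- than (d − M)/2 non-neighbours in S form a clique, so at least d − ω vertices of S have
-- that many, whence (d − ω)(d − M) ≤ 2(nM + d), and this forces d² ≤ 4n(ω + t)^t.

module Submission where

open import Defs hiding (sym)
open import Data.Bool using (Bool; true; false; _∧_; _∨_; not; if_then_else_; T)
open import Data.Bool.Properties using (∧-comm; ∧-identityʳ; ∧-zeroʳ; ∨-identityʳ)
open import Data.Empty using (⊥-elim)
open import Data.Fin using (Fin; zero; suc)
open import Data.Fin.Properties using (_≟_)
open import Data.Fin.Subset using (Subset; inside; outside; ∣_∣; _∈_)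
open import Data.Nat
  using (ℕ; zero; suc; _≤_; _<_; _+_; _*_; _∸_; _^_; z≤n; s≤s; s≤s⁻¹; _≤ᵇ_; _≤?_; _<?_)
open import Data.Nat.Properties hiding (_≟_)
open import Data.Nat.Tactic.RingSolver using (solve-∀)
open import Data.Product using (Σ; _×_; _,_; proj₁; proj₂; ∃)
open import Data.Sum using (_⊎_; inj₁; inj₂)
open import Data.Vec using (tabulate)
open import Data.Vec.Functional using (_∷_)
open import Data.Vec.Properties using (lookup∘tabulate; []=⇒lookup)
open import Function using (_∘_)
open import Function.Definitions using (Injective)
open import Relation.Binary.PropositionalEquality
  using (_≡_; _≢_; _≗_; refl; sym; trans; cong; cong₂; subst)
open import Relation.Nullary using (¬_; does; yes; no)

open import Algebra.Properties.CommutativeSemigroup +-commutativeSemigroup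
  using () renaming (interchange to +-interchange)
open import Algebra.Properties.Semiring.Sum +-*-semiring
  using (sum; sum-syntax; sum-cong-≗; ∑-distrib-+; ∑-comm; *-distribˡ-sum; *-distribʳ-sum)

-- Counting Boolean predicates on Fin n

∧-true⁻¹ : ∀ a b → a ∧ b ≡ true → a ≡ true × b ≡ true
∧-true⁻¹ true _ e = refl , e

∧-true : ∀ {a b} → a ≡ true → b ≡ true → a ∧ b ≡ true
∧-true refl refl = refl

∨-true⁻¹ : ∀ a {b} → a ∨ b ≡ true → a ≡ true ⊎ b ≡ true
∨-true⁻¹ true  _ = inj₁ refl
∨-true⁻¹ false e = inj₂ e

𝟙 : Bool → ℕ
𝟙 true  = 1
𝟙 false = 0

count : ∀ {n} → (Fin n → Bool) → ℕ
count {n} P = ∑[ x < n ] 𝟙 (P x)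

_⊆ᵇ_ : ∀ {n} → (Fin n → Bool) → (Fin n → Bool) → Set
P ⊆ᵇ Q = ∀ x → P x ≡ true → Q x ≡ true

_≟ᵇ_ : ∀ {n} → Fin n → Fin n → Bool
x ≟ᵇ y = does (x ≟ y)

_∪⁅_⁆ : ∀ {n} → (Fin n → Bool) → Fin n → (Fin n → Bool)
(P ∪⁅ v ⁆) x = P x ∨ x ≟ᵇ v

≟ᵇ⇒≡ : ∀ {n} (x y : Fin n) → x ≟ᵇ y ≡ true → x ≡ y
≟ᵇ⇒≡ x y e with x ≟ y
≟ᵇ⇒≡ x y _  | yes x≡y = x≡y
≟ᵇ⇒≡ x y () | no _

∪⁅⁆-⊆ : ∀ {n} {P Q : Fin n → Bool} {v} → P ⊆ᵇ Q → Q v ≡ true → (P ∪⁅ v ⁆) ⊆ᵇ Q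
∪⁅⁆-⊆ {P = P} {Q} {v} P⊆Q Qv x x∈ with ∨-true⁻¹ (P x) x∈
... | inj₁ Px  = P⊆Q x Px
... | inj₂ x=v = subst (λ y → Q y ≡ true) (sym (≟ᵇ⇒≡ x v x=v)) Qv

sum-mono-≤ : ∀ {n} {f g : Fin n → ℕ} → (∀ i → f i ≤ g i) → sum f ≤ sum g
sum-mono-≤ {zero}  f≤g = z≤n
sum-mono-≤ {suc n} f≤g = +-mono-≤ (f≤g zero) (sum-mono-≤ (f≤g ∘ suc))

sum-≤-* : ∀ {n} {f : Fin n → ℕ} c → (∀ i → f i ≤ c) → sum f ≤ n * c
sum-≤-* {zero}  c f≤c = z≤n
sum-≤-* {suc n} c f≤c = +-mono-≤ (f≤c zero) (sum-≤-* c (f≤c ∘ suc))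

count-cong : ∀ {n} {P Q : Fin n → Bool} → P ≗ Q → count P ≡ count Q
count-cong P≗Q = sum-cong-≗ (cong 𝟙 ∘ P≗Q)

count-false : ∀ n → count {n} (λ _ → false) ≡ 0
count-false zero    = refl
count-false (suc n) = count-false n

count-≟ᵇ : ∀ {n} (v : Fin n) → count (_≟ᵇ v) ≡ 1
count-≟ᵇ {suc n} zero    = cong suc (count-false n)
count-≟ᵇ {suc n} (suc v) = count-≟ᵇ v

count-∪⁅⁆ : ∀ {n} (P : Fin n → Bool) v → P v ≡ false → count (P ∪⁅ v ⁆) ≡ suc (count P)
count-∪⁅⁆ {suc n} P zero    Pv rewrite Pv =
  cong suc (count-cong (λ x → ∨-identityʳ (P (suc x))))
count-∪⁅⁆ {suc n} P (suc v) Pv =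
  trans (cong₂ _+_ (cong 𝟙 (∨-identityʳ (P zero))) (count-∪⁅⁆ (P ∘ suc) v Pv))
        (+-suc (𝟙 (P zero)) (count (P ∘ suc)))

∃-of-count>0 : ∀ {n} (P : Fin n → Bool) → 0 < count P → ∃ λ x → P x ≡ true
∃-of-count>0 {suc n} P count>0 with P zero in P0
... | true  = zero , P0
... | false = let x , Px = ∃-of-count>0 (P ∘ suc) count>0 in suc x , Px

module _ {n : ℕ} where

  count-mono : {P Q : Fin n → Bool} → P ⊆ᵇ Q → count P ≤ count Q
  count-mono {P} {Q} P⊆Q = sum-mono-≤ 𝟙-mono
    where
    𝟙-mono : ∀ x → 𝟙 (P x) ≤ 𝟙 (Q x)
    𝟙-mono x with P x in Px
    ... | false = z≤n
    ... | true rewrite P⊆Q x Px = ≤-refl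

  count≤n : (P : Fin n → Bool) → count P ≤ n
  count≤n P = ≤-trans (sum-≤-* 1 (𝟙≤1 ∘ P)) (≤-reflexive (*-identityʳ n))
    where
    𝟙≤1 : ∀ b → 𝟙 b ≤ 1
    𝟙≤1 true  = ≤-refl
    𝟙≤1 false = z≤n

  count-split : (P Q : Fin n → Bool) →
    count P ≡ count (λ x → P x ∧ Q x) + count (λ x → P x ∧ not (Q x))
  count-split P Q = trans (sum-cong-≗ (λ x → 𝟙-split (P x) (Q x)))
                          (∑-distrib-+ (λ x → 𝟙 (P x ∧ Q x)) (λ x → 𝟙 (P x ∧ not (Q x))))
    where
    𝟙-split : ∀ a b → 𝟙 a ≡ 𝟙 (a ∧ b) + 𝟙 (a ∧ not b)
    𝟙-split true  true  = refl
    𝟙-split true  false = refl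
    𝟙-split false _     = refl

  𝟙-*-count : ∀ b (Q : Fin n → Bool) → 𝟙 b * count Q ≡ count (λ x → b ∧ Q x)
  𝟙-*-count true  Q = +-identityʳ _
  𝟙-*-count false Q = sym (count-false n)

  count-∧+count-∧≤ : (P Q R : Fin n → Bool) →
    count (λ x → P x ∧ Q x) + count (λ x → P x ∧ R x) ≤ count P + count (λ x → Q x ∧ R x)
  count-∧+count-∧≤ P Q R = begin
    count (λ x → P x ∧ Q x) + count (λ x → P x ∧ R x)
      ≡⟨ ∑-distrib-+ (λ x → 𝟙 (P x ∧ Q x)) (λ x → 𝟙 (P x ∧ R x)) ⟨
    ∑[ x < n ] (𝟙 (P x ∧ Q x) + 𝟙 (P x ∧ R x))
      ≤⟨ sum-mono-≤ (λ x → 𝟙-∧+𝟙-∧≤ (P x) (Q x) (R x)) ⟩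
    ∑[ x < n ] (𝟙 (P x) + 𝟙 (Q x ∧ R x))
      ≡⟨ ∑-distrib-+ (𝟙 ∘ P) (λ x → 𝟙 (Q x ∧ R x)) ⟩
    count P + count (λ x → Q x ∧ R x)
      ∎
    where
    open ≤-Reasoning
    𝟙-∧+𝟙-∧≤ : ∀ p q r → 𝟙 (p ∧ q) + 𝟙 (p ∧ r) ≤ 𝟙 p + 𝟙 (q ∧ r)
    𝟙-∧+𝟙-∧≤ true  true  true  = ≤-refl
    𝟙-∧+𝟙-∧≤ true  true  false = ≤-refl
    𝟙-∧+𝟙-∧≤ true  false true  = ≤-refl
    𝟙-∧+𝟙-∧≤ true  false false = z≤n
    𝟙-∧+𝟙-∧≤ false q     r     = z≤n

  count-remove : (P : Fin n → Bool) (v : Fin n) → count P ≤ suc (count (λ x → P x ∧ not (x ≟ᵇ v)))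
  count-remove P v = begin
    count P                                                          ≡⟨ count-split P (_≟ᵇ v) ⟩
    count (λ x → P x ∧ x ≟ᵇ v) + count (λ x → P x ∧ not (x ≟ᵇ v))   ≤⟨ +-monoˡ-≤ _ at-most-v ⟩
    1 + count (λ x → P x ∧ not (x ≟ᵇ v))                             ∎
    where
    open ≤-Reasoning
    at-most-v : count (λ x → P x ∧ x ≟ᵇ v) ≤ 1
    at-most-v = ≤-trans (count-mono (λ x → proj₂ ∘ ∧-true⁻¹ (P x) (x ≟ᵇ v)))
                        (≤-reflexive (count-≟ᵇ v))

toSubset : ∀ {n} → (Fin n → Bool) → Subset n
toSubset P = tabulate (λ x → if P x then inside else outside)

∣toSubset∣ : ∀ {n} (P : Fin n → Bool) → ∣ toSubset P ∣ ≡ count P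
∣toSubset∣ {zero}  P = refl
∣toSubset∣ {suc n} P with P zero
... | true  = cong suc (∣toSubset∣ (P ∘ suc))
... | false = ∣toSubset∣ (P ∘ suc)

∈toSubset⁻ : ∀ {n} {P : Fin n → Bool} {x} → x ∈ toSubset P → P x ≡ true
∈toSubset⁻ {P = P} {x} x∈P with P x | trans (sym (lookup∘tabulate _ x)) ([]=⇒lookup x∈P)
... | true  | _  = refl
... | false | ()

-- Ramsey's theorem

-- ramsey s r + 1 is the Erdős–Szekeres bound for the Ramsey number R(s + 1, r + 1).
ramsey : ℕ → ℕ → ℕ
ramsey zero    r       = 0
ramsey (suc s) zero    = 0
ramsey (suc s) (suc r) = suc (ramsey s (suc r) + ramsey (suc s) r)

suc-ramsey≤ : ∀ s r → suc (ramsey s r) ≤ suc s ^ r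
suc-ramsey≤ zero    r       = ≤-reflexive (sym (^-zeroˡ r))
suc-ramsey≤ (suc s) zero    = ≤-refl
suc-ramsey≤ (suc s) (suc r) = begin
  suc (suc (ramsey s (suc r) + ramsey (suc s) r))
    ≡⟨ shuffle (ramsey s (suc r)) (ramsey (suc s) r) ⟩
  suc (ramsey (suc s) r) + suc (ramsey s (suc r))
    ≤⟨ +-mono-≤ (suc-ramsey≤ (suc s) r) (suc-ramsey≤ s (suc r)) ⟩
  suc (suc s) ^ r + suc s * suc s ^ r
    ≤⟨ +-monoʳ-≤ (suc (suc s) ^ r) (*-monoʳ-≤ (suc s) (^-monoˡ-≤ r (n≤1+n (suc s)))) ⟩
  suc (suc s) ^ r + suc s * suc (suc s) ^ r
    ∎
  where
  open ≤-Reasoning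
  shuffle : ∀ a b → suc (suc (a + b)) ≡ suc b + suc a
  shuffle = solve-∀

+-<-split : ∀ a b x y → a + b < x + y → a < x ⊎ b < y
+-<-split a b x y a+b<x+y with a <? x
... | yes a<x = inj₁ a<x
... | no  a≮x = inj₂ (+-cancelˡ-< x b y (≤-<-trans (+-monoˡ-≤ b (≮⇒≥ a≮x)) a+b<x+y))

module _ {n : ℕ} (G : Graph n) where

  -- Cliques are Boolean predicates, so that `count` measures them; independent sets are
  -- injections, as HasInducedK requires.
  IsCliqueᵇ : (Fin n → Bool) → Set
  IsCliqueᵇ K = ∀ x y → K x ≡ true → K y ≡ true → x ≢ y → adj G x y ≡ true

  IsIndependent : ∀ {r} → (Fin r → Fin n) → Set
  IsIndependent f = Injective _≡_ _≡_ f × (∀ i j → adj G (f i) (f j) ≡ false)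

  HasCliqueIn : (Fin n → Bool) → ℕ → Set
  HasCliqueIn P s = Σ (Fin n → Bool) λ K → K ⊆ᵇ P × IsCliqueᵇ K × s ≤ count K

  HasIndependentIn : (Fin n → Bool) → ℕ → Set
  HasIndependentIn P r = Σ (Fin r → Fin n) λ f → IsIndependent f × (∀ i → P (f i) ≡ true)

  ⊆-nbhd⇒∉ : ∀ {K v} → K ⊆ᵇ adj G v → K v ≡ false
  ⊆-nbhd⇒∉ {K} {v} K⊆Nv with K v in Kv
  ... | false = refl
  ... | true  = trans (sym (K⊆Nv v Kv)) (loopless G v)

  IsCliqueᵇ-∪⁅⁆ : ∀ {K v} → K ⊆ᵇ adj G v → IsCliqueᵇ K → IsCliqueᵇ (K ∪⁅ v ⁆)
  IsCliqueᵇ-∪⁅⁆ {K} {v} K⊆Nv K-clique x y x∈ y∈ x≢y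
    with ∨-true⁻¹ (K x) x∈ | ∨-true⁻¹ (K y) y∈
  ... | inj₁ Kx | inj₁ Ky = K-clique x y Kx Ky x≢y
  ... | inj₁ Kx | inj₂ y=v rewrite ≟ᵇ⇒≡ y v y=v = trans (Graph.sym G x v) (K⊆Nv x Kx)
  ... | inj₂ x=v | inj₁ Ky rewrite ≟ᵇ⇒≡ x v x=v = K⊆Nv y Ky
  ... | inj₂ x=v | inj₂ y=v = ⊥-elim (x≢y (trans (≟ᵇ⇒≡ x v x=v) (sym (≟ᵇ⇒≡ y v y=v))))

  HasCliqueIn-∪⁅⁆ : ∀ {P K v s} → P v ≡ true → K ⊆ᵇ (λ x → P x ∧ adj G v x) →
    IsCliqueᵇ K → s ≤ count K → HasCliqueIn P (suc s)
  HasCliqueIn-∪⁅⁆ {P} {K} {v} Pv K⊆PNv K-clique s≤∣K∣ =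
    K ∪⁅ v ⁆ ,
    ∪⁅⁆-⊆ (λ x → proj₁ ∘ ∧-true⁻¹ (P x) (adj G v x) ∘ K⊆PNv x) Pv ,
    IsCliqueᵇ-∪⁅⁆ K⊆Nv K-clique ,
    ≤-trans (s≤s s≤∣K∣) (≤-reflexive (sym (count-∪⁅⁆ K v (⊆-nbhd⇒∉ K⊆Nv))))
    where
    K⊆Nv : K ⊆ᵇ adj G v
    K⊆Nv x = proj₂ ∘ ∧-true⁻¹ (P x) (adj G v x) ∘ K⊆PNv x

  HasCliqueIn-⊆ : ∀ {P Q s} → P ⊆ᵇ Q → HasCliqueIn P s → HasCliqueIn Q s
  HasCliqueIn-⊆ P⊆Q (K , K⊆P , K-clique , s≤∣K∣) = K , (λ x → P⊆Q x ∘ K⊆P x) , K-clique , s≤∣K∣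

  HasIndependentIn-⊆ : ∀ {P Q r} → P ⊆ᵇ Q → HasIndependentIn P r → HasIndependentIn Q r
  HasIndependentIn-⊆ P⊆Q (f , f-indep , f∈P) = f , f-indep , (λ i → P⊆Q (f i) (f∈P i))

  IsIndependent-∷ : ∀ {r v} {f : Fin r → Fin n} → IsIndependent f →
    (∀ i → f i ≢ v) → (∀ i → adj G v (f i) ≡ false) → IsIndependent (v ∷ f)
  IsIndependent-∷ {v = v} {f} (f-inj , f-indep) f≢v v≁f = inj , indep
    where
    inj : Injective _≡_ _≡_ (v ∷ f)
    inj {zero}  {zero}  _ = refl
    inj {zero}  {suc j} e = ⊥-elim (f≢v j (sym e))
    inj {suc i} {zero}  e = ⊥-elim (f≢v i e)
    inj {suc i} {suc j} e = cong suc (f-inj e)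
    indep : ∀ i j → adj G ((v ∷ f) i) ((v ∷ f) j) ≡ false
    indep zero    zero    = loopless G v
    indep zero    (suc j) = v≁f j
    indep (suc i) zero    = trans (Graph.sym G (f i) v) (v≁f i)
    indep (suc i) (suc j) = f-indep i j

  nbrsIn nonNbrsIn : (Fin n → Bool) → Fin n → Fin n → Bool
  nbrsIn    P v x = P x ∧ adj G v x
  nonNbrsIn P v x = (P x ∧ not (adj G v x)) ∧ not (x ≟ᵇ v)

  nonNbrsIn⁻¹ : ∀ P v x → nonNbrsIn P v x ≡ true → P x ≡ true × adj G v x ≡ false × x ≢ v
  nonNbrsIn⁻¹ P v x e with P x | adj G v x | x ≟ v | e
  ... | true | false | no x≢v | _ = refl , refl , x≢v

  count≤nbrsIn+nonNbrsIn : ∀ P v → count P ≤ suc (count (nbrsIn P v) + count (nonNbrsIn P v))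
  count≤nbrsIn+nonNbrsIn P v = begin
    count P                                                    ≡⟨ count-split P (adj G v) ⟩
    count (nbrsIn P v) + count (λ x → P x ∧ not (adj G v x))   ≤⟨ +-monoʳ-≤ _ (count-remove _ v) ⟩
    count (nbrsIn P v) + suc (count (nonNbrsIn P v))           ≡⟨ +-suc _ _ ⟩
    suc (count (nbrsIn P v) + count (nonNbrsIn P v))           ∎
    where open ≤-Reasoning

  clique-or-independent : ∀ s r (P : Fin n → Bool) → ramsey s r < count P →
    HasCliqueIn P (suc s) ⊎ HasIndependentIn P (suc r)
  clique-or-independent s r P r<∣P∣ with ∃-of-count>0 P (≤-<-trans z≤n r<∣P∣)
  clique-or-independent zero r P _ | v , Pv =
    inj₁ (HasCliqueIn-∪⁅⁆ {K = λ _ → false} Pv (λ _ ()) (λ _ _ ()) z≤n)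
  clique-or-independent (suc s) zero P _ | v , Pv =
    inj₂ ((λ _ → v) , ((λ { {zero} {zero} _ → refl }) , (λ _ _ → loopless G v)) , (λ _ → Pv))
  clique-or-independent (suc s) (suc r) P r<∣P∣ | v , Pv
    with +-<-split (ramsey s (suc r)) (ramsey (suc s) r) _ _
           (s≤s⁻¹ (<-≤-trans r<∣P∣ (count≤nbrsIn+nonNbrsIn P v)))
  ... | inj₁ r<∣P₁∣ with clique-or-independent s (suc r) (nbrsIn P v) r<∣P₁∣
  ...   | inj₁ (K , K⊆ , K-clique , s≤∣K∣) = inj₁ (HasCliqueIn-∪⁅⁆ Pv K⊆ K-clique s≤∣K∣)
  ...   | inj₂ I = inj₂ (HasIndependentIn-⊆ (λ x → proj₁ ∘ ∧-true⁻¹ (P x) (adj G v x)) I)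
  clique-or-independent (suc s) (suc r) P r<∣P∣ | v , Pv
      | inj₂ r<∣P₂∣ with clique-or-independent (suc s) r (nonNbrsIn P v) r<∣P₂∣
  ...   | inj₁ C = inj₁ (HasCliqueIn-⊆ (λ x → proj₁ ∘ nonNbrsIn⁻¹ P v x) C)
  ...   | inj₂ (f , f-indep , f∈) =
    inj₂ (v ∷ f ,
          IsIndependent-∷ f-indep (λ i → proj₂ (proj₂ (nonNbrsIn⁻¹ P v (f i) (f∈ i))))
                                  (λ i → proj₁ (proj₂ (nonNbrsIn⁻¹ P v (f i) (f∈ i)))) ,
          λ { zero → Pv ; (suc i) → proj₁ (nonNbrsIn⁻¹ P v (f i) (f∈ i)) })

  adj⇒≢ : ∀ {x y} → adj G x y ≡ true → x ≢ y
  adj⇒≢ {x} x∼x refl with () ← trans (sym x∼x) (loopless G x)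

  count≤ω : ∀ {w K} → IsCliqueNumber G w → IsCliqueᵇ K → count K ≤ w
  count≤ω {w} {K} (_ , maximal) K-clique =
    subst (_≤ w) (∣toSubset∣ K)
      (maximal (toSubset K) (λ x y x∈K y∈K → K-clique x y (∈toSubset⁻ x∈K) (∈toSubset⁻ y∈K)))

  HasCliqueIn⇒≤ω : ∀ {w P s} → IsCliqueNumber G w → HasCliqueIn P s → s ≤ w
  HasCliqueIn⇒≤ω ω (K , _ , K-clique , s≤∣K∣) = ≤-trans s≤∣K∣ (count≤ω ω K-clique)

  commonNbrs : Fin n → Fin n → Fin n → Bool
  commonNbrs a b x = adj G a x ∧ adj G b x

  HasInducedK-commonNbrs : ∀ {a b r} → a ≢ b → adj G a b ≡ false →
    HasIndependentIn (commonNbrs a b) r → HasInducedK G 2 r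
  HasInducedK-commonNbrs {a} {b} a≢b a≁b (f , (f-inj , f-indep) , f∈) = emb , inj , adj-emb
    where
    a∼f : ∀ j → adj G a (f j) ≡ true
    b∼f : ∀ j → adj G b (f j) ≡ true
    a∼f j = proj₁ (∧-true⁻¹ (adj G a (f j)) (adj G b (f j)) (f∈ j))
    b∼f j = proj₂ (∧-true⁻¹ (adj G a (f j)) (adj G b (f j)) (f∈ j))

    emb : Fin 2 ⊎ Fin _ → Fin n
    emb (inj₁ zero)    = a
    emb (inj₁ (suc _)) = b
    emb (inj₂ j)       = f j

    inj : Injective _≡_ _≡_ emb
    inj {inj₁ zero}          {inj₁ zero}          _ = refl
    inj {inj₁ zero}          {inj₁ (suc zero)}    e = ⊥-elim (a≢b e)
    inj {inj₁ (suc zero)}    {inj₁ zero}          e = ⊥-elim (a≢b (sym e))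
    inj {inj₁ (suc zero)}    {inj₁ (suc zero)}    _ = refl
    inj {inj₁ zero}          {inj₂ j}             e = ⊥-elim (adj⇒≢ (a∼f j) e)
    inj {inj₁ (suc zero)}    {inj₂ j}             e = ⊥-elim (adj⇒≢ (b∼f j) e)
    inj {inj₂ i}             {inj₁ zero}          e = ⊥-elim (adj⇒≢ (a∼f i) (sym e))
    inj {inj₂ i}             {inj₁ (suc zero)}    e = ⊥-elim (adj⇒≢ (b∼f i) (sym e))
    inj {inj₂ i}             {inj₂ j}             e = cong inj₂ (f-inj e)

    adj-emb : ∀ x y → adj G (emb x) (emb y) ≡ Kadj x y
    adj-emb (inj₁ zero)       (inj₁ zero)       = loopless G a
    adj-emb (inj₁ zero)       (inj₁ (suc zero)) = a≁b
    adj-emb (inj₁ (suc zero)) (inj₁ zero)       = trans (Graph.sym G b a) a≁b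
    adj-emb (inj₁ (suc zero)) (inj₁ (suc zero)) = loopless G b
    adj-emb (inj₁ zero)       (inj₂ j)          = a∼f j
    adj-emb (inj₁ (suc zero)) (inj₂ j)          = b∼f j
    adj-emb (inj₂ i)          (inj₁ zero)       = trans (Graph.sym G (f i) a) (a∼f i)
    adj-emb (inj₂ i)          (inj₁ (suc zero)) = trans (Graph.sym G (f i) b) (b∼f i)
    adj-emb (inj₂ i)          (inj₂ j)          = f-indep i j

  codegree≤ramsey : ∀ {t w} → IsCliqueNumber G w → ¬ HasInducedK G 2 (suc t) →
    ∀ a b → a ≢ b → adj G a b ≡ false → count (commonNbrs a b) ≤ ramsey (w ∸ 1) t
  codegree≤ramsey {t} {w} ω no-K a b a≢b a≁b
    with ramsey (w ∸ 1) t <? count (commonNbrs a b)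
  ... | no  ≮ = ≮⇒≥ ≮
  ... | yes ramsey<codeg with clique-or-independent (w ∸ 1) t _ ramsey<codeg
  ...   | inj₂ I = ⊥-elim (no-K (HasInducedK-commonNbrs a≢b a≁b I))
  ...   | inj₁ (K , K⊆ab , K-clique , w≤1+∣K∣) =
    ⊥-elim (<⇒≱ (s≤s (m≤n+m∸n w 1))
      (HasCliqueIn⇒≤ω ω (HasCliqueIn-∪⁅⁆ {P = λ _ → true} refl K⊆a K-clique w≤1+∣K∣)))
    where
    K⊆a : K ⊆ᵇ adj G a
    K⊆a x = proj₁ ∘ ∧-true⁻¹ (adj G a x) (adj G b x) ∘ K⊆ab x

-- The counting argument around a vertex of minimum degree

module KeyInequality {n} (G : Graph n) {d w M : ℕ} (u : Fin n)
  (deg-u : count (adj G u) ≡ d)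
  (δ≥d : ∀ v → d ≤ count (adj G v))
  (codeg≤M : ∀ a b → a ≢ b → adj G a b ≡ false → count (commonNbrs G a b) ≤ M)
  (ω≤w : ∀ {K} → IsCliqueᵇ G K → count K ≤ w)
  where

  S : Fin n → Bool
  S = adj G u

  inS missing outS : Fin n → ℕ
  inS     y = count (λ x → S x ∧ adj G y x)
  missing y = count (λ x → S x ∧ not (adj G y x))
  outS    y = count (λ x → adj G y x ∧ not (S x))

  inS+missing≡d : ∀ y → inS y + missing y ≡ d
  inS+missing≡d y = trans (sym (count-split S (adj G y))) deg-u

  missing≤outS : ∀ y → missing y ≤ outS y
  missing≤outS y = +-cancelˡ-≤ (inS y) _ _ (begin
    inS y + missing y                         ≡⟨ inS+missing≡d y ⟩
    d                                         ≤⟨ δ≥d y ⟩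
    count (adj G y)                           ≡⟨ count-split (adj G y) S ⟩
    count (λ x → adj G y x ∧ S x) + outS y    ≡⟨ cong (_+ outS y) (count-cong (λ x → ∧-comm (adj G y x) (S x))) ⟩
    inS y + outS y                            ∎)
    where open ≤-Reasoning

  edges-from-S-to : ∀ v → count (λ y → S y ∧ (adj G y v ∧ not (S v))) ≤ M + 𝟙 (v ≟ᵇ u) * d
  edges-from-S-to v with S v in Sv
  ... | true = ≤-trans (≤-reflexive (trans (count-cong none) (count-false n))) z≤n
    where
    none : (λ y → S y ∧ (adj G y v ∧ false)) ≗ (λ _ → false)
    none y = trans (cong (S y ∧_) (∧-zeroʳ (adj G y v))) (∧-zeroʳ (S y))
  ... | false with v ≟ u
  ...   | yes refl = begin
    count (λ y → S y ∧ (adj G y u ∧ true))   ≤⟨ count-mono (λ y → proj₁ ∘ ∧-true⁻¹ (S y) _) ⟩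
    count S                                  ≡⟨ deg-u ⟩
    d                                        ≤⟨ m≤n+m d M ⟩
    M + d                                    ≡⟨ cong (M +_) (*-identityˡ d) ⟨
    M + 1 * d                                ∎
    where open ≤-Reasoning
  ...   | no v≢u = begin
    count (λ y → S y ∧ (adj G y v ∧ true))   ≤⟨ count-mono S∧v∼⊆common ⟩
    count (commonNbrs G u v)                 ≤⟨ codeg≤M u v (v≢u ∘ sym) Sv ⟩
    M                                        ≡⟨ +-identityʳ M ⟨
    M + 0                                    ∎
    where
    open ≤-Reasoning
    S∧v∼⊆common : (λ y → S y ∧ (adj G y v ∧ true)) ⊆ᵇ commonNbrs G u v
    S∧v∼⊆common y e with ∧-true⁻¹ (S y) _ e
    ... | Sy , y∼v = ∧-true Sy (trans (Graph.sym G v y) (trans (sym (∧-identityʳ (adj G y v))) y∼v))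

  -- Each y ∈ S has at least missing y neighbours outside S, as its degree is at least d,
  -- while each v ∉ S other than u has at most M neighbours in S.
  totalMissing : ℕ
  totalMissing = ∑[ y < n ] (𝟙 (S y) * missing y)

  totalMissing≤ : totalMissing ≤ n * M + d
  totalMissing≤ = begin
    ∑[ y < n ] (𝟙 (S y) * missing y)
      ≤⟨ sum-mono-≤ (λ y → *-monoʳ-≤ (𝟙 (S y)) (missing≤outS y)) ⟩
    ∑[ y < n ] (𝟙 (S y) * outS y)
      ≡⟨ sum-cong-≗ (λ y → 𝟙-*-count (S y) (λ v → adj G y v ∧ not (S v))) ⟩
    ∑[ y < n ] ∑[ v < n ] 𝟙 (S y ∧ (adj G y v ∧ not (S v)))
      ≡⟨ ∑-comm (λ y v → 𝟙 (S y ∧ (adj G y v ∧ not (S v)))) ⟩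
    ∑[ v < n ] count (λ y → S y ∧ (adj G y v ∧ not (S v)))
      ≤⟨ sum-mono-≤ edges-from-S-to ⟩
    ∑[ v < n ] (M + 𝟙 (v ≟ᵇ u) * d)
      ≡⟨ ∑-distrib-+ (λ _ → M) (λ v → 𝟙 (v ≟ᵇ u) * d) ⟩
    ∑[ v < n ] M + ∑[ v < n ] (𝟙 (v ≟ᵇ u) * d)
      ≡⟨ cong (∑[ v < n ] M +_) (*-distribʳ-sum d (𝟙 ∘ (_≟ᵇ u))) ⟨
    ∑[ v < n ] M + count (_≟ᵇ u) * d
      ≡⟨ cong (λ c → ∑[ v < n ] M + c * d) (count-≟ᵇ u) ⟩
    ∑[ v < n ] M + 1 * d
      ≤⟨ +-mono-≤ (sum-≤-* {n} M (λ _ → ≤-refl)) (≤-reflexive (*-identityˡ d)) ⟩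
    n * M + d                                                          ∎
    where open ≤-Reasoning

  D : ℕ
  D = d ∸ M

  -- Two non-adjacent vertices of S miss at least D vertices of S between them, so the
  -- vertices missing fewer than D / 2 form a clique.
  isLarge S-large S-small : Fin n → Bool
  isLarge y = D ≤ᵇ 2 * missing y
  S-large y = S y ∧ isLarge y
  S-small y = S y ∧ not (isLarge y)

  inS+inS≤d+M : ∀ y z → y ≢ z → adj G y z ≡ false → inS y + inS z ≤ d + M
  inS+inS≤d+M y z y≢z y≁z = begin
    inS y + inS z                         ≤⟨ count-∧+count-∧≤ S (adj G y) (adj G z) ⟩
    count S + count (commonNbrs G y z)    ≤⟨ +-mono-≤ (≤-reflexive deg-u) (codeg≤M y z y≢z y≁z) ⟩
    d + M                                 ∎
    where open ≤-Reasoning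

  D≤missing+missing : ∀ y z → y ≢ z → adj G y z ≡ false → D ≤ missing y + missing z
  D≤missing+missing y z y≢z y≁z = m≤n+o⇒m∸n≤o d M (+-cancelˡ-≤ d _ _ (begin
    d + d                                          ≡⟨ cong₂ _+_ (inS+missing≡d y) (inS+missing≡d z) ⟨
    (inS y + missing y) + (inS z + missing z)      ≡⟨ +-interchange (inS y) (missing y) (inS z) (missing z) ⟩
    (inS y + inS z) + (missing y + missing z)      ≤⟨ +-monoˡ-≤ _ (inS+inS≤d+M y z y≢z y≁z) ⟩
    (d + M) + (missing y + missing z)              ≡⟨ +-assoc d M _ ⟩
    d + (M + (missing y + missing z))              ∎))
    where open ≤-Reasoning

  S-small⇒2*missing<D : ∀ y → S-small y ≡ true → 2 * missing y < D
  S-small⇒2*missing<D y y-small with S y | isLarge y in large? | y-small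
  ... | true | false | _ = ≰⇒> (λ D≤2m → subst T large? (≤⇒≤ᵇ D≤2m))

  S-small-isClique : IsCliqueᵇ G S-small
  S-small-isClique y z y-small z-small y≢z with adj G y z in y∼z
  ... | true  = refl
  ... | false = ⊥-elim (<⇒≱ 2m+2m<D+D D+D≤2m+2m)
    where
    open ≤-Reasoning
    2m+2m<D+D : 2 * missing y + 2 * missing z < D + D
    2m+2m<D+D = +-mono-< (S-small⇒2*missing<D y y-small) (S-small⇒2*missing<D z z-small)
    D≤ : D ≤ missing y + missing z
    D≤ = D≤missing+missing y z y≢z y∼z
    double : ∀ a b → (a + b) + (a + b) ≡ 2 * a + 2 * b
    double = solve-∀
    D+D≤2m+2m : D + D ≤ 2 * missing y + 2 * missing z
    D+D≤2m+2m = begin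
      D + D                                              ≤⟨ +-mono-≤ D≤ D≤ ⟩
      (missing y + missing z) + (missing y + missing z)  ≡⟨ double (missing y) (missing z) ⟩
      2 * missing y + 2 * missing z                      ∎

  S-large-weight : ∀ y → 𝟙 (S-large y) * D ≤ 2 * (𝟙 (S y) * missing y)
  S-large-weight y with S y | isLarge y in large?
  ... | false | _     = z≤n
  ... | true  | false = z≤n
  ... | true  | true  = begin
    1 * D                  ≡⟨ *-identityˡ D ⟩
    D                      ≤⟨ ≤ᵇ⇒≤ D _ (subst T (sym large?) _) ⟩
    2 * missing y          ≡⟨ cong (2 *_) (*-identityˡ (missing y)) ⟨
    2 * (1 * missing y)    ∎
    where open ≤-Reasoning

  ∣S-large∣*D≤ : count S-large * D ≤ 2 * totalMissing
  ∣S-large∣*D≤ = begin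
    count S-large * D                        ≡⟨ *-distribʳ-sum D (𝟙 ∘ S-large) ⟩
    ∑[ y < n ] (𝟙 (S-large y) * D)           ≤⟨ sum-mono-≤ S-large-weight ⟩
    ∑[ y < n ] (2 * (𝟙 (S y) * missing y))   ≡⟨ *-distribˡ-sum 2 (λ y → 𝟙 (S y) * missing y) ⟨
    2 * totalMissing                         ∎
    where open ≤-Reasoning

  d∸w≤∣S-large∣ : d ∸ w ≤ count S-large
  d∸w≤∣S-large∣ = m≤n+o⇒m∸n≤o d w (begin
    d                                ≡⟨ trans (sym deg-u) (count-split S isLarge) ⟩
    count S-large + count S-small    ≤⟨ +-monoʳ-≤ (count S-large) (ω≤w S-small-isClique) ⟩
    count S-large + w                ≡⟨ +-comm (count S-large) w ⟩
    w + count S-large                ∎)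
    where open ≤-Reasoning

  key-inequality : (d ∸ w) * (d ∸ M) ≤ 2 * (n * M + d)
  key-inequality = begin
    (d ∸ w) * D          ≤⟨ *-monoˡ-≤ D d∸w≤∣S-large∣ ⟩
    count S-large * D    ≤⟨ ∣S-large∣*D≤ ⟩
    2 * totalMissing     ≤⟨ *-monoʳ-≤ 2 totalMissing≤ ⟩
    2 * (n * M + d)      ∎
    where open ≤-Reasoning

-- Arithmetic consequences

m≤m^n : ∀ m {n} → 1 ≤ n → m ≤ m ^ n
m≤m^n zero    _   = z≤n
m≤m^n (suc m) 1≤n = ≤-trans (≤-reflexive (sym (*-identityʳ (suc m)))) (^-monoʳ-≤ (suc m) 1≤n)

3*d≤4*[d∸w] : ∀ d w → 4 * w ≤ d → 3 * d ≤ 4 * (d ∸ w)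
3*d≤4*[d∸w] d w 4w≤d = begin
  3 * d                    ≡⟨ cong (3 *_) (m∸n+n≡m (≤-trans (m≤n*m w 4) 4w≤d)) ⟨
  3 * ((d ∸ w) + w)        ≡⟨ *-distribˡ-+ 3 (d ∸ w) w ⟩
  3 * (d ∸ w) + 3 * w      ≤⟨ +-monoʳ-≤ (3 * (d ∸ w)) (m+n≤o⇒m≤o∸n (3 * w) 3w+w≤d) ⟩
  3 * (d ∸ w) + (d ∸ w)    ≡⟨ +-comm (3 * (d ∸ w)) (d ∸ w) ⟩
  4 * (d ∸ w)              ∎
  where
  open ≤-Reasoning
  3w+w≤d : 3 * w + w ≤ d
  3w+w≤d = ≤-trans (≤-reflexive (+-comm (3 * w) w)) 4w≤d

d*d≤4*[n*X]-small : ∀ {n d c X} → d ≤ n → d ≤ 4 * c → c ≤ X → d * d ≤ 4 * (n * X)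
d*d≤4*[n*X]-small {n} {d} {c} {X} d≤n d≤4c c≤X = begin
  d * d            ≤⟨ *-mono-≤ d≤4c d≤n ⟩
  4 * c * n        ≤⟨ *-monoˡ-≤ n (*-monoʳ-≤ 4 c≤X) ⟩
  4 * X * n        ≡⟨ *-assoc 4 X n ⟩
  4 * (X * n)      ≡⟨ cong (4 *_) (*-comm X n) ⟩
  4 * (n * X)      ∎
  where open ≤-Reasoning

d*d≤4*[n*X] : ∀ {n d w M X} → d ≤ n → (d ∸ w) * (d ∸ M) ≤ 2 * (n * M + d) →
  M < X → w ≤ X → d * d ≤ 4 * (n * X)
d*d≤4*[n*X] {n} {d} {w} {M} {X} d≤n key M<X w≤X with d ≤? 4 * w | d ≤? 4 * M
... | yes d≤4w | _        = d*d≤4*[n*X]-small d≤n d≤4w w≤X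
... | no  _    | yes d≤4M = d*d≤4*[n*X]-small d≤n d≤4M (<⇒≤ M<X)
... | no  d≰4w | no  d≰4M = *-cancelˡ-≤ 9 (begin
  9 * (d * d)                     ≡⟨ square3 d ⟩
  (3 * d) * (3 * d)               ≤⟨ *-mono-≤ (3*d≤4*[d∸w] d w (≰⇒≥ d≰4w)) (3*d≤4*[d∸w] d M (≰⇒≥ d≰4M)) ⟩
  (4 * (d ∸ w)) * (4 * (d ∸ M))   ≡⟨ 4*4 (d ∸ w) (d ∸ M) ⟩
  16 * ((d ∸ w) * (d ∸ M))        ≤⟨ *-monoʳ-≤ 16 key ⟩
  16 * (2 * (n * M + d))          ≤⟨ *-monoʳ-≤ 16 (*-monoʳ-≤ 2 (+-monoʳ-≤ (n * M) d≤n)) ⟩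
  16 * (2 * (n * M + n))          ≡⟨ regroup n M ⟩
  32 * (n * suc M)                ≤⟨ *-mono-≤ (m≤m+n 32 4) (*-monoʳ-≤ n M<X) ⟩
  36 * (n * X)                    ≡⟨ *-assoc 9 4 (n * X) ⟩
  9 * (4 * (n * X))               ∎)
  where
  open ≤-Reasoning
  square3 : ∀ d → 9 * (d * d) ≡ (3 * d) * (3 * d)
  square3 = solve-∀
  4*4 : ∀ a b → (4 * a) * (4 * b) ≡ 16 * (a * b)
  4*4 = solve-∀
  regroup : ∀ n M → 16 * (2 * (n * M + n)) ≡ 32 * (n * suc M)
  regroup = solve-∀

min-degree²-bound : ∀ {n} (G : Graph n) {t d w} → 1 ≤ t → IsMinDegree G d →
  ¬ HasInducedK G 2 (suc t) → IsCliqueNumber G w → d * d ≤ 4 * (n * (w + t) ^ t)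
min-degree²-bound {n} G {t} {d} {w} t≥1 (δ≥d , u , deg-u) no-K ω =
  d*d≤4*[n*X] d≤n
    (KeyInequality.key-inequality G u deg-u′ δ≥d′ (codegree≤ramsey G ω no-K) (count≤ω G ω))
    ramsey<X (≤-trans (m≤m+n w t) (m≤m^n (w + t) t≥1))
  where
  deg-u′ : count (adj G u) ≡ d
  deg-u′ = trans (sym (∣toSubset∣ (adj G u))) deg-u
  δ≥d′ : ∀ v → d ≤ count (adj G v)
  δ≥d′ v = subst (d ≤_) (∣toSubset∣ (adj G v)) (δ≥d v)
  d≤n : d ≤ n
  d≤n = subst (_≤ n) deg-u′ (count≤n (adj G u))
  ramsey<X : ramsey (w ∸ 1) t < (w + t) ^ t
  ramsey<X = ≤-trans (suc-ramsey≤ (w ∸ 1) t) (^-monoˡ-≤ t 1+[w∸1]≤w+t)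
    where
    1+[w∸1]≤w+t : suc (w ∸ 1) ≤ w + t
    1+[w∸1]≤w+t = ≤-trans (s≤s (m∸n≤m w 1)) (≤-trans (+-monoˡ-≤ w t≥1) (≤-reflexive (+-comm t w)))

theorem3 : (t : ℕ) → 2 ≤ t → (k : ℕ) → 1 ≤ k →
    Σ ℕ (λ N → (n : ℕ) → N ≤ n → (G : Graph n) → (d w : ℕ) →
      IsMinDegree G d → ¬ HasInducedK G 2 (suc t) → IsCliqueNumber G w →
      (k ∸ 1) * (d * d) ≤ (w + t) ^ t * (2 * n * t * k))
-- No o(1) is needed: the bound d² ≤ 4n(ω + t)^t holds for every n, and 4 ≤ 2t.
theorem3 t t≥2 k _ = 0 , λ n _ G d w δ no-K ω → begin
  (k ∸ 1) * (d * d)               ≤⟨ *-monoˡ-≤ (d * d) (m∸n≤m k 1) ⟩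
  k * (d * d)                     ≤⟨ *-monoʳ-≤ k (min-degree²-bound G (≤-trans (n≤1+n 1) t≥2) δ no-K ω) ⟩
  k * (4 * (n * (w + t) ^ t))     ≤⟨ *-monoʳ-≤ k (*-monoˡ-≤ (n * (w + t) ^ t) (*-monoʳ-≤ 2 t≥2)) ⟩
  k * (2 * t * (n * (w + t) ^ t)) ≡⟨ rearrange k t n ((w + t) ^ t) ⟩
  (w + t) ^ t * (2 * n * t * k)   ∎
  where
  open ≤-Reasoning
  rearrange : ∀ k t n X → k * (2 * t * (n * X)) ≡ X * (2 * n * t * k)
  rearrange = solve-∀
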